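{- Let $l\ge3$, $d\ge1$ and let $f:V\to V$ be a partial function. (i) If $L\not\subseteq Dom(f)$, then $f\in W(l,d)$ if and only if $Dom(f)$ is open and $|f(L)|\le1$. (ii) If $L\subseteq Dom(f)$, then $f\in W(l,d)$ if and only if $|f(L)|=1$ or the restriction of $f$ to $L$ is a permutation of $L$.
   Context: For $l\ge3$, $d\ge1$, let $V=\{1,\dots,l+d\}$, $L=\{1,\dots,l\}$, $D=\{l+1,\dots,l+d\}$, and let $M(l,d)$ be the pairwise balanced design on $V$ whose blocks are $L$ together with all $\{i,j\}$ with $l+1\le j\le l+d$, $1\le i<j$. A subsystem is a set $F\subseteq V$ such that for all distinct $x,y\in F$ the unique block containing $x,y$ lies in $F$; a set is open if its complement is a subsystem. For a partial function $f$, $f(A)=f(A\cap Dom(f))$ and $f^{ -w}(B)=f^{ -1}(B)\cup(V\setminus Dom(f))$. $W(l,d)$ is the monoid of all partial functions $f:V\to V$ such that $f^{ -w}(F)$ is a subsystem for every subsystem $F$. -}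

module Defs where

open import Data.Nat using (ℕ; _+_; _<_; _≤_)
open import Data.Nat.Properties using (_<?_)
open import Data.Bool using (Bool; true; false)
open import Data.Fin using (Fin; toℕ)
open import Data.Fin.Properties using (any?)
open import Data.Fin.Subset using (Subset; _∈_; _⊆_; ∁; ⁅_⁆; _∪_; ∣_∣)
open import Data.Fin.Subset.Properties using (_∈?_)
open import Data.Maybe using (Maybe; just; nothing; maybe; is-just)
open import Data.Maybe.Properties using (≡-dec)
open import Data.Vec using (tabulate; lookup)
open import Data.Product using (Σ; _×_; ∃; ∃-syntax; _,_)
open import Data.Sum using (_⊎_)
open import Relation.Nullary using (¬_)
open import Relation.Nullary.Decidable using (⌊_⌋; _×-dec_)
open import Relation.Binary.PropositionalEquality using (_≡_; _≢_)
import Data.Fin.Properties as FinP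

-- Points of V = {1,…,l+d} are represented (0-indexed) by Fin (l + d):
-- the point k+1 of the paper is the element with toℕ = k.
-- Thus L = {x | toℕ x < l} and D = {x | l ≤ toℕ x}.

module _ (l d : ℕ) where

  V : Set
  V = Fin (l + d)

  Lset : Subset (l + d)
  Lset = tabulate (λ x → ⌊ toℕ x <? l ⌋)

  IsBlock : Subset (l + d) → Set
  IsBlock B = (B ≡ Lset)
            ⊎ (Σ V λ i → Σ V λ j → (l ≤ toℕ j) × (toℕ i < toℕ j) × (B ≡ ⁅ i ⁆ ∪ ⁅ j ⁆))

  Subsystem : Subset (l + d) → Set
  Subsystem F = ∀ (B : Subset (l + d)) → IsBlock B →
                ∀ (x y : V) → x ≢ y → x ∈ B → y ∈ B → x ∈ F → y ∈ F → B ⊆ F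

  PFun : Set
  PFun = V → Maybe V

  Dom : PFun → Subset (l + d)
  Dom f = tabulate (λ x → is-just (f x))

  IsOpen : Subset (l + d) → Set
  IsOpen A = Subsystem (∁ A)

  image : PFun → Subset (l + d) → Subset (l + d)
  image f A = tabulate (λ y →
    ⌊ any? (λ x → (x ∈? A) ×-dec (≡-dec FinP._≟_ (f x) (just y))) ⌋)

  -- weak preimage f^{-w}(B) = f^{-1}(B) ∪ (V ∖ Dom f)
  preimageW : PFun → Subset (l + d) → Subset (l + d)
  preimageW f B = tabulate (λ x → maybe (λ y → lookup B y) true (f x))

  InW : PFun → Set
  InW f = ∀ (F : Subset (l + d)) → Subsystem F → Subsystem (preimageW f F)

  RestrictionIsPermOfL : PFun → Set
  RestrictionIsPermOfL f =
      (∀ x → x ∈ Lset → Σ V λ y → (f x ≡ just y) × (y ∈ Lset))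
    × (∀ x y z → x ∈ Lset → y ∈ Lset → f x ≡ just z → f y ≡ just z → x ≡ y)
    × (∀ y → y ∈ Lset → Σ V λ x → (x ∈ Lset) × (f x ≡ just y))

module Submission where

-- Every block other than L is a pair, so F is a subsystem iff it is
-- L-closed: two distinct points of L in F force L ⊆ F.  Hence f ∈ W means:
-- two distinct points of L weakly mapped into a subsystem F force all of L
-- to be weakly mapped into F ('spread').  Sufficiency: an open Dom f with at
-- most one value on L, or a permutation of L, makes every weak preimage
-- L-closed.  Necessity: the weak preimage of ∅ is ∁ Dom f, so Dom f is open;
-- spreading over singletons {p} makes f constant on L as soon as two points
-- of L are undefined or identified; for f injective on L ⊆ Dom f, spreading
-- over L and over pairs {a,b} ⊄ L (using l ≥ 3) gives f(L) ⊆ L, and the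
-- pigeonhole principle makes f|L a permutation.

open import Defs
open import Data.Nat using (ℕ; _≤_; _<_; _+_; zero; suc; z≤n; s≤s)
open import Data.Nat.Properties using (_<?_; n<1+n; <-irrefl; ≤-reflexive; module ≤-Reasoning)
open import Data.Bool using (Bool; true)
open import Data.Fin using (Fin; zero; suc; toℕ; punchOut)
open import Data.Fin.Properties using (any?; _≟_; punchOut-injective; <⇒notInjective)
open import Data.Fin.Subset using (Subset; _∈_; _∉_; _⊆_; ∣_∣; ⁅_⁆; _∪_; ⊥; ∁; _-_)
open import Data.Fin.Subset.Properties
  using (_∈?_; nonempty?; Empty-unique; ∉⊥; x∈⁅x⁆; x∈⁅y⁆⇒x≡y; ∣⁅x⁆∣≡1; ∣⊥∣≡0; ⊆-antisym;
         p⊆q⇒∣p∣≤∣q∣; x∈p∪q⁻; x∈p∪q⁺; x∈∁p⇒x∉p; x∉p⇒x∈∁p; x∈p∧x≢y⇒x∈p-y; x∈p⇒∣p-x∣<∣p∣)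
open import Data.Maybe using (Maybe; just; nothing; maybe; is-just)
open import Data.Maybe.Properties using (≡-dec; just-injective)
open import Data.Vec using (tabulate; lookup)
open import Data.Vec.Properties using (lookup∘tabulate; []=⇒lookup; lookup⇒[]=)
open import Data.Product using (Σ; ∃; _×_; _,_; proj₁; proj₂)
open import Data.Sum using (_⊎_; inj₁; inj₂; [_,_])
open import Relation.Nullary using (¬_; Dec; yes; no; _×-dec_; ¬?; contradiction)
open import Relation.Nullary.Decidable using (⌊_⌋)
open import Relation.Binary.PropositionalEquality using (_≡_; _≢_; refl; sym; trans; cong; subst)
open import Function.Bundles using (_⇔_; mk⇔; Equivalence)
open import Function.Definitions using (Injective)
open import Function.Construct.Composition using (_⇔-∘_)
open import Function.Construct.Symmetry using (⇔-sym)

open Equivalence using (to; from)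

⌊⌋≡true⇔ : ∀ {A : Set} (a? : Dec A) → ⌊ a? ⌋ ≡ true ⇔ A
⌊⌋≡true⇔ (yes a) = mk⇔ (λ _ → a) (λ _ → refl)
⌊⌋≡true⇔ (no ¬a) = mk⇔ (λ ()) (λ a → contradiction a ¬a)

∈-tabulate⇔ : ∀ {n} (g : Fin n → Bool) {x : Fin n} → x ∈ tabulate g ⇔ g x ≡ true
∈-tabulate⇔ g {x} = mk⇔ (λ x∈ → trans (sym (lookup∘tabulate g x)) ([]=⇒lookup x∈))
                        (λ gx → lookup⇒[]= x _ (trans (lookup∘tabulate g x) gx))

∈-decided⇔ : ∀ {n} {P : Fin n → Set} (P? : ∀ x → Dec (P x)) {x : Fin n} →
             x ∈ tabulate (λ x → ⌊ P? x ⌋) ⇔ P x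
∈-decided⇔ P? {x} = ⌊⌋≡true⇔ (P? x) ⇔-∘ ∈-tabulate⇔ (λ x → ⌊ P? x ⌋) {x}

∣∣≤1-intro : ∀ {n} (S : Subset n) → (∀ {a b} → a ∈ S → b ∈ S → a ≡ b) → ∣ S ∣ ≤ 1
∣∣≤1-intro {n} S unique with nonempty? S
... | yes (a , a∈S) = subst (∣ S ∣ ≤_) (∣⁅x⁆∣≡1 a) (p⊆q⇒∣p∣≤∣q∣ S⊆⁅a⁆)
  where
  S⊆⁅a⁆ : S ⊆ ⁅ a ⁆
  S⊆⁅a⁆ b∈S = subst (_∈ ⁅ a ⁆) (unique a∈S b∈S) (x∈⁅x⁆ a)
... | no empty = subst (_≤ 1) (sym (trans (cong ∣_∣ (Empty-unique empty)) (∣⊥∣≡0 n))) z≤n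

-- Conversely, two elements of a subset with at most one element coincide:
-- otherwise S - a would still contain b, and would be strictly smaller than S.
∣∣≤1-elim : ∀ {n} {S : Subset n} → ∣ S ∣ ≤ 1 → ∀ {a b} → a ∈ S → b ∈ S → a ≡ b
∣∣≤1-elim {S = S} ∣S∣≤1 {a} {b} a∈S b∈S with a ≟ b
... | yes a≡b = a≡b
... | no a≢b = contradiction 1<1 (<-irrefl refl)
  where
  open ≤-Reasoning
  ⁅b⁆⊆S-a : ⁅ b ⁆ ⊆ S - a
  ⁅b⁆⊆S-a c∈⁅b⁆ = subst (_∈ S - a) (sym (x∈⁅y⁆⇒x≡y b c∈⁅b⁆))
                        (x∈p∧x≢y⇒x∈p-y b∈S (λ b≡a → a≢b (sym b≡a)))
  1<1 : 1 < 1
  1<1 = begin-strict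
    1           ≡⟨ sym (∣⁅x⁆∣≡1 b) ⟩
    ∣ ⁅ b ⁆ ∣   ≤⟨ p⊆q⇒∣p∣≤∣q∣ ⁅b⁆⊆S-a ⟩
    ∣ S - a ∣   <⟨ x∈p⇒∣p-x∣<∣p∣ a∈S ⟩
    ∣ S ∣       ≤⟨ ∣S∣≤1 ⟩
    1           ∎

∣∣≡1-intro : ∀ {n} (S : Subset n) {a} → a ∈ S → (∀ {b} → b ∈ S → b ≡ a) → ∣ S ∣ ≡ 1
∣∣≡1-intro S {a} a∈S only-a = trans (cong ∣_∣ (⊆-antisym S⊆⁅a⁆ ⁅a⁆⊆S)) (∣⁅x⁆∣≡1 a)
  where
  S⊆⁅a⁆ : S ⊆ ⁅ a ⁆
  S⊆⁅a⁆ b∈S = subst (_∈ ⁅ a ⁆) (sym (only-a b∈S)) (x∈⁅x⁆ a)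
  ⁅a⁆⊆S : ⁅ a ⁆ ⊆ S
  ⁅a⁆⊆S b∈⁅a⁆ = subst (_∈ S) (sym (x∈⁅y⁆⇒x≡y a b∈⁅a⁆)) a∈S

-- Pigeonhole: an injective self-map of Fin n is onto, since a map missing y
-- would inject Fin (suc m) into Fin m after removing y from the codomain.
injective⇒onto : ∀ n (h : Fin n → Fin n) → Injective _≡_ _≡_ h → ∀ y → ∃ λ x → h x ≡ y
injective⇒onto (suc m) h h-inj y with any? (λ x → h x ≟ y)
... | yes hit = hit
... | no miss = contradiction (λ {x} {x′} → squeeze-injective {x} {x′}) (<⇒notInjective (n<1+n m))
  where
  squeeze : Fin (suc m) → Fin m
  squeeze x = punchOut {i = y} {j = h x} (λ y≡hx → miss (x , sym y≡hx))
  squeeze-injective : Injective _≡_ _≡_ squeeze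
  squeeze-injective {x} {x′} e =
    h-inj (punchOut-injective (λ y≡hx → miss (x , sym y≡hx)) (λ y≡hx′ → miss (x′ , sym y≡hx′)) e)

-- It is proved by extending
-- the map by the identity outside S to an injective self-map of Fin n.
module _ {n} (S : Subset n) (f : Fin n → Maybe (Fin n))
         (into : ∀ x → x ∈ S → Σ (Fin n) λ y → (f x ≡ just y) × (y ∈ S))
         (inj : ∀ x y z → x ∈ S → y ∈ S → f x ≡ just z → f y ≡ just z → x ≡ y)
         where

  private
    extend : (x : Fin n) → Dec (x ∈ S) → Fin n
    extend x (yes x∈S) = proj₁ (into x x∈S)
    extend x (no _)    = x

    g : Fin n → Fin n
    g x = extend x (x ∈? S)

    g-spec : ∀ x → (x ∈ S × f x ≡ just (g x) × g x ∈ S) ⊎ (x ∉ S × g x ≡ x)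
    g-spec x = spec (x ∈? S)
      where
      spec : (x? : Dec (x ∈ S)) →
             (x ∈ S × f x ≡ just (extend x x?) × extend x x? ∈ S) ⊎ (x ∉ S × extend x x? ≡ x)
      spec (yes x∈S) = inj₁ (x∈S , proj₂ (into x x∈S))
      spec (no x∉S)  = inj₂ (x∉S , refl)

    g-injective : Injective _≡_ _≡_ g
    g-injective {x} {x′} gx≡gx′ with g-spec x | g-spec x′
    ... | inj₁ (x∈S , fx , _) | inj₁ (x′∈S , fx′ , _) =
      inj x x′ (g x′) x∈S x′∈S (trans fx (cong just gx≡gx′)) fx′
    ... | inj₁ (_ , _ , gx∈S) | inj₂ (x′∉S , gx′≡x′) =
      contradiction (subst (_∈ S) (trans gx≡gx′ gx′≡x′) gx∈S) x′∉S
    ... | inj₂ (x∉S , gx≡x) | inj₁ (_ , _ , gx′∈S) =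
      contradiction (subst (_∈ S) (trans (sym gx≡gx′) gx≡x) gx′∈S) x∉S
    ... | inj₂ (_ , gx≡x) | inj₂ (_ , gx′≡x′) = trans (sym gx≡x) (trans gx≡gx′ gx′≡x′)

  injective-into⇒onto : ∀ y → y ∈ S → Σ (Fin n) λ x → (x ∈ S) × (f x ≡ just y)
  injective-into⇒onto y y∈S with injective⇒onto n g g-injective y
  ... | x , gx≡y with g-spec x
  ...   | inj₁ (x∈S , fx , _) = x , x∈S , trans fx (cong just gx≡y)
  ...   | inj₂ (x∉S , gx≡x)   = contradiction (subst (_∈ S) (trans (sym gx≡y) gx≡x) y∈S) x∉S

∈pair : ∀ {n} {i j z : Fin n} → z ∈ ⁅ i ⁆ ∪ ⁅ j ⁆ → z ≡ i ⊎ z ≡ j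
∈pair {i = i} {j} z∈ with x∈p∪q⁻ ⁅ i ⁆ ⁅ j ⁆ z∈
... | inj₁ z∈⁅i⁆ = inj₁ (x∈⁅y⁆⇒x≡y i z∈⁅i⁆)
... | inj₂ z∈⁅j⁆ = inj₂ (x∈⁅y⁆⇒x≡y j z∈⁅j⁆)

pair-exhausted : ∀ {n} {i j x y z : Fin n} → x ≢ y →
                 x ∈ ⁅ i ⁆ ∪ ⁅ j ⁆ → y ∈ ⁅ i ⁆ ∪ ⁅ j ⁆ → z ∈ ⁅ i ⁆ ∪ ⁅ j ⁆ → z ≡ x ⊎ z ≡ y
pair-exhausted x≢y x∈ y∈ z∈ = cases x≢y (∈pair x∈) (∈pair y∈) (∈pair z∈)
  where
  cases : ∀ {A : Set} {i j x y z : A} → x ≢ y →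
          x ≡ i ⊎ x ≡ j → y ≡ i ⊎ y ≡ j → z ≡ i ⊎ z ≡ j → z ≡ x ⊎ z ≡ y
  cases _   (inj₁ refl) _           (inj₁ refl) = inj₁ refl
  cases _   (inj₂ refl) _           (inj₂ refl) = inj₁ refl
  cases _   (inj₁ refl) (inj₂ refl) (inj₂ refl) = inj₂ refl
  cases _   (inj₂ refl) (inj₁ refl) (inj₁ refl) = inj₂ refl
  cases x≢x (inj₁ refl) (inj₁ refl) (inj₂ refl) = contradiction refl x≢x
  cases x≢x (inj₂ refl) (inj₂ refl) (inj₁ refl) = contradiction refl x≢x

module Design (l d : ℕ) where

  L : Subset (l + d)
  L = Lset l d

  ∈L⇔ : ∀ {x : V l d} → x ∈ L ⇔ toℕ x < l
  ∈L⇔ = ∈-decided⇔ (λ x → toℕ x <? l)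

  -- F is L-closed if two distinct points of L in F put all of L in F.  As
  -- every block other than L is a pair, this is the subsystem condition.
  LClosed : Subset (l + d) → Set
  LClosed F = ∀ {x y} → x ≢ y → x ∈ L → y ∈ L → x ∈ F → y ∈ F → L ⊆ F

  subsystem⇒LClosed : ∀ {F} → Subsystem l d F → LClosed F
  subsystem⇒LClosed sub {x} {y} x≢y = sub L (inj₁ refl) x y x≢y

  -- A pair block {i, j} lies in any set containing two distinct of its points.
  LClosed⇒subsystem : ∀ {F} → LClosed F → Subsystem l d F
  LClosed⇒subsystem closed B (inj₁ refl) x y x≢y x∈L y∈L = closed x≢y x∈L y∈L
  LClosed⇒subsystem closed B (inj₂ (i , j , _ , _ , refl)) x y x≢y x∈B y∈B x∈F y∈F z∈B
    with pair-exhausted x≢y x∈B y∈B z∈B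
  ... | inj₁ refl = x∈F
  ... | inj₂ refl = y∈F

  LClosed-resp : ∀ {F G} → (∀ {x} → x ∈ F ⇔ x ∈ G) → LClosed F → LClosed G
  LClosed-resp F≈G closed x≢y x∈L y∈L x∈G y∈G z∈L =
    to F≈G (closed x≢y x∈L y∈L (from F≈G x∈G) (from F≈G y∈G) z∈L)

  ⊥-subsystem : Subsystem l d ⊥
  ⊥-subsystem = LClosed⇒subsystem (λ _ _ _ x∈⊥ _ → contradiction x∈⊥ ∉⊥)

  singleton-subsystem : ∀ a → Subsystem l d ⁅ a ⁆
  singleton-subsystem a = LClosed⇒subsystem λ x≢y _ _ x∈ y∈ →
    contradiction (trans (x∈⁅y⁆⇒x≡y a x∈) (sym (x∈⁅y⁆⇒x≡y a y∈))) x≢y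

  L-subsystem : Subsystem l d L
  L-subsystem = LClosed⇒subsystem (λ _ _ _ _ _ z∈L → z∈L)

  pair-subsystem : ∀ a b → ¬ (a ∈ L × b ∈ L) → Subsystem l d (⁅ a ⁆ ∪ ⁅ b ⁆)
  pair-subsystem a b ¬a,b∈L = LClosed⇒subsystem closed
    where
    closed : LClosed (⁅ a ⁆ ∪ ⁅ b ⁆)
    closed x≢y x∈L y∈L x∈ y∈ with ∈pair x∈ | ∈pair y∈
    ... | inj₁ refl | inj₁ refl = contradiction refl x≢y
    ... | inj₂ refl | inj₂ refl = contradiction refl x≢y
    ... | inj₁ refl | inj₂ refl = contradiction (x∈L , y∈L) ¬a,b∈L
    ... | inj₂ refl | inj₁ refl = contradiction (y∈L , x∈L) ¬a,b∈L

record LTriple (l d : ℕ) : Set where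
  open Design l d
  field
    u₀ u₁ u₂ : V l d
    u₀∈L : u₀ ∈ L
    u₁∈L : u₁ ∈ L
    u₂∈L : u₂ ∈ L
    u₀≢u₁ : u₀ ≢ u₁
    u₂≢u₀ : u₂ ≢ u₀
    u₂≢u₁ : u₂ ≢ u₁

three-points : ∀ {l d} → 3 ≤ l → LTriple l d
three-points {suc (suc (suc k))} {d} (s≤s (s≤s (s≤s _))) = record
  { u₀ = zero ; u₁ = suc zero ; u₂ = suc (suc zero)
  ; u₀∈L = from ∈L⇔ (s≤s z≤n)
  ; u₁∈L = from ∈L⇔ (s≤s (s≤s z≤n))
  ; u₂∈L = from ∈L⇔ (s≤s (s≤s (s≤s z≤n)))
  ; u₀≢u₁ = λ () ; u₂≢u₀ = λ () ; u₂≢u₁ = λ ()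
  }
  where open Design (suc (suc (suc k))) d

module Map (l d : ℕ) (f : PFun l d) where
  open Design l d
  open LTriple

  P : Subset (l + d) → Subset (l + d)
  P = preimageW l d f

  MapsInto : Subset (l + d) → V l d → Set
  MapsInto F x = ∀ {y} → f x ≡ just y → y ∈ F

  ∈P⇔ : ∀ {F x} → x ∈ P F ⇔ MapsInto F x
  ∈P⇔ {F} {x} = maybe-lookup⇔ (f x) ⇔-∘ ∈-tabulate⇔ (λ x → maybe (lookup F) true (f x))
    where
    maybe-lookup⇔ : ∀ (m : Maybe (V l d)) →
                    maybe (lookup F) true m ≡ true ⇔ (∀ {y} → m ≡ just y → y ∈ F)
    maybe-lookup⇔ nothing  = mk⇔ (λ { _ () }) (λ _ → refl)
    maybe-lookup⇔ (just y) = mk⇔ (λ { Fy refl → lookup⇒[]= y F Fy }) (λ into → []=⇒lookup (into refl))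

  undefined⇒∈P : ∀ {F x} → f x ≡ nothing → x ∈ P F
  undefined⇒∈P {F} {x} fx = from (∈P⇔ {F} {x}) λ fx′ → contradiction (trans (sym fx) fx′) λ ()

  mapped⇒∈P : ∀ {F x y} → f x ≡ just y → y ∈ F → x ∈ P F
  mapped⇒∈P fx y∈F = from ∈P⇔ λ fx′ → subst (_∈ _) (just-injective (trans (sym fx) fx′)) y∈F

  ∈Dom⇔ : ∀ {x} → x ∈ Dom l d f ⇔ ∃ λ y → f x ≡ just y
  ∈Dom⇔ {x} = is-just⇔ (f x) ⇔-∘ ∈-tabulate⇔ (λ x → is-just (f x))
    where
    is-just⇔ : ∀ (m : Maybe (V l d)) → is-just m ≡ true ⇔ ∃ λ y → m ≡ just y
    is-just⇔ nothing  = mk⇔ (λ ()) (λ { (_ , ()) })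
    is-just⇔ (just y) = mk⇔ (λ _ → y , refl) (λ _ → refl)

  ∈∁Dom⇔ : ∀ {x} → x ∈ ∁ (Dom l d f) ⇔ f x ≡ nothing
  ∈∁Dom⇔ {x} = mk⇔ undefined (λ fx → x∉p⇒x∈∁p λ x∈Dom → absurd fx (to ∈Dom⇔ x∈Dom))
    where
    absurd : f x ≡ nothing → ¬ (∃ λ y → f x ≡ just y)
    absurd fx (_ , fx′) with () ← trans (sym fx) fx′
    undefined : x ∈ ∁ (Dom l d f) → f x ≡ nothing
    undefined x∉Dom with f x in fx
    ... | nothing = refl
    ... | just y  = contradiction (from ∈Dom⇔ (y , fx)) (x∈∁p⇒x∉p x∉Dom)

  ∈image⇔ : ∀ {A y} → y ∈ image l d f A ⇔ ∃ λ x → x ∈ A × f x ≡ just y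
  ∈image⇔ {A} = ∈-decided⇔ (λ y → any? λ x → (x ∈? A) ×-dec ≡-dec _≟_ (f x) (just y))

  ∈P⊥⇔ : ∀ {x} → x ∈ P ⊥ ⇔ x ∈ ∁ (Dom l d f)
  ∈P⊥⇔ {x} = ⇔-sym ∈∁Dom⇔ ⇔-∘ mk⇔ (λ x∈P⊥ → undefined (to ∈P⇔ x∈P⊥)) (undefined⇒∈P {⊥})
    where
    undefined : MapsInto ⊥ x → f x ≡ nothing
    undefined into with f x
    ... | nothing = refl
    ... | just y  = contradiction (into refl) ∉⊥

  spread : InW l d f → ∀ {F} → Subsystem l d F → LClosed (P F)
  spread w sub = subsystem⇒LClosed (w _ sub)

  -- If z ∈ L has a value, then x or y has one too (Dom f is
  -- open), and that value equals f z and lies in F.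
  open-single-valued⇒W : IsOpen l d (Dom l d f) → ∣ image l d f L ∣ ≤ 1 → InW l d f
  open-single-valued⇒W dom-open one-value F _ = LClosed⇒subsystem closed
    where
    same-value : ∀ {x z a c} → x ∈ L → z ∈ L → f x ≡ just a → f z ≡ just c → a ≡ c
    same-value x∈L z∈L fx fz =
      ∣∣≤1-elim one-value (from ∈image⇔ (_ , x∈L , fx)) (from ∈image⇔ (_ , z∈L , fz))
    closed : LClosed (P F)
    closed {x} {y} x≢y x∈L y∈L x∈P y∈P {z} z∈L = from ∈P⇔ value∈F
      where
      value∈F : MapsInto F z
      value∈F {c} fz with f x in fx | f y in fy
      ... | just a | _ = subst (_∈ F) (same-value x∈L z∈L fx fz) (to ∈P⇔ x∈P fx)
      ... | nothing | just b = subst (_∈ F) (same-value y∈L z∈L fy fz) (to ∈P⇔ y∈P fy)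
      ... | nothing | nothing =
        contradiction (trans (sym fz) (to ∈∁Dom⇔ (subsystem⇒LClosed dom-open x≢y x∈L y∈L
                        (from ∈∁Dom⇔ fx) (from ∈∁Dom⇔ fy) z∈L))) λ ()

  L⊆Dom⇒open : L ⊆ Dom l d f → IsOpen l d (Dom l d f)
  L⊆Dom⇒open L⊆Dom = LClosed⇒subsystem λ _ x∈L _ x∉Dom _ _ →
    contradiction (L⊆Dom x∈L) (x∈∁p⇒x∉p x∉Dom)

  -- Sufficiency (ii): a permutation of L pulls L-closed sets back to
  -- L-closed sets, since distinct points of L have distinct images in L.
  permutation⇒W : RestrictionIsPermOfL l d f → InW l d f
  permutation⇒W (into , inj , _) F sub = LClosed⇒subsystem closed
    where
    closed : LClosed (P F)
    closed {x} {y} x≢y x∈L y∈L x∈P y∈P {z} z∈L with into x x∈L | into y y∈L | into z z∈L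
    ... | u , fx , u∈L | v , fy , v∈L | w , fz , w∈L =
      mapped⇒∈P fz (subsystem⇒LClosed sub u≢v u∈L v∈L (to ∈P⇔ x∈P fx) (to ∈P⇔ y∈P fy) w∈L)
      where
      u≢v : u ≢ v
      u≢v refl = x≢y (inj x y u x∈L y∈L fx fy)

  -- Necessity of an open domain: the weak preimage of ∅ is ∁ Dom f.
  W⇒open : InW l d f → IsOpen l d (Dom l d f)
  W⇒open w = LClosed⇒subsystem (LClosed-resp ∈P⊥⇔ (spread w ⊥-subsystem))

  -- If two distinct points of L are weakly mapped to p, then p is the only
  -- value of f on L (spread over the subsystem {p}).
  forced-value : InW l d f → ∀ {x₁ x₂ p b} → x₁ ≢ x₂ → x₁ ∈ L → x₂ ∈ L →
                 x₁ ∈ P ⁅ p ⁆ → x₂ ∈ P ⁅ p ⁆ → b ∈ image l d f L → b ≡ p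
  forced-value w {p = p} x₁≢x₂ x₁∈L x₂∈L x₁∈P x₂∈P b∈f[L] with to ∈image⇔ b∈f[L]
  ... | z , z∈L , fz = x∈⁅y⁆⇒x≡y p
        (to ∈P⇔ (spread w (singleton-subsystem p) x₁≢x₂ x₁∈L x₂∈L x₁∈P x₂∈P z∈L) fz)

  undefined-point : ¬ (L ⊆ Dom l d f) → ∃ λ a → a ∈ L × f a ≡ nothing
  undefined-point L⊈Dom with any? (λ x → (x ∈? L) ×-dec ¬? (x ∈? Dom l d f))
  ... | yes (a , a∈L , a∉Dom) = a , a∈L , to ∈∁Dom⇔ (x∉p⇒x∈∁p a∉Dom)
  ... | no none = contradiction (λ {x} → L⊆Dom {x}) L⊈Dom
    where
    L⊆Dom : L ⊆ Dom l d f
    L⊆Dom {x} x∈L with x ∈? Dom l d f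
    ... | yes x∈Dom = x∈Dom
    ... | no x∉Dom  = contradiction (x , x∈L , x∉Dom) none

  -- Necessity (i): with an undefined point a₀ ∈ L, each value a = f x of f on
  -- L is forced, since a₀ and x are weakly mapped to a.
  W⇒single-valued : InW l d f → (∃ λ a₀ → a₀ ∈ L × f a₀ ≡ nothing) → ∣ image l d f L ∣ ≤ 1
  W⇒single-valued w (a₀ , a₀∈L , fa₀) = ∣∣≤1-intro _ λ a∈ b∈ → sym (unique a∈ b∈)
    where
    unique : ∀ {a b} → a ∈ image l d f L → b ∈ image l d f L → b ≡ a
    unique {a} a∈ b∈ with to ∈image⇔ a∈
    ... | x , x∈L , fx =
      forced-value w a₀≢x a₀∈L x∈L (undefined⇒∈P {⁅ a ⁆} fa₀) (mapped⇒∈P fx (x∈⁅x⁆ a)) b∈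
      where
      a₀≢x : a₀ ≢ x
      a₀≢x refl with () ← trans (sym fa₀) fx

  collapse⇒constant : InW l d f → L ⊆ Dom l d f → ∀ {x₁ x₂} → x₁ ≢ x₂ → x₁ ∈ L → x₂ ∈ L →
                      f x₁ ≡ f x₂ → ∣ image l d f L ∣ ≡ 1
  collapse⇒constant w L⊆Dom {x₁} {x₂} x₁≢x₂ x₁∈L x₂∈L fx₁≡fx₂ with to ∈Dom⇔ (L⊆Dom x₁∈L)
  ... | p , fx₁ = ∣∣≡1-intro _ (from ∈image⇔ (x₁ , x₁∈L , fx₁))
                    (forced-value w x₁≢x₂ x₁∈L x₂∈L (mapped⇒∈P fx₁ (x∈⁅x⁆ p))
                                  (mapped⇒∈P (trans (sym fx₁≡fx₂) fx₁) (x∈⁅x⁆ p)))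

  InjectiveOnL : Set
  InjectiveOnL = ∀ x y z → x ∈ L → y ∈ L → f x ≡ just z → f y ≡ just z → x ≡ y

  -- For an injective W-map and distinct u₀, u₁, u₂ ∈ L, the images of u₀, u₁
  -- lie in L: otherwise {f u₀, f u₁} is a subsystem, whose weak preimage
  -- contains u₀, u₁, hence u₂, so f u₂ would repeat f u₀ or f u₁.
  first-two-in-L : InW l d f → InjectiveOnL → (t : LTriple l d) → ∀ {a₀ a₁ a₂} →
                   f (u₀ t) ≡ just a₀ → f (u₁ t) ≡ just a₁ → f (u₂ t) ≡ just a₂ → a₀ ∈ L × a₁ ∈ L
  first-two-in-L w inj t {a₀} {a₁} fu₀ fu₁ fu₂ with (a₀ ∈? L) ×-dec (a₁ ∈? L)
  ... | yes both = both
  ... | no ¬both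
    with ∈pair {i = a₀} {j = a₁}
           (to ∈P⇔ (spread w (pair-subsystem a₀ a₁ ¬both) (u₀≢u₁ t) (u₀∈L t) (u₁∈L t)
                      (mapped⇒∈P fu₀ (x∈p∪q⁺ (inj₁ (x∈⁅x⁆ a₀))))
                      (mapped⇒∈P fu₁ (x∈p∪q⁺ {p = ⁅ a₀ ⁆} (inj₂ (x∈⁅x⁆ a₁))))
                      (u₂∈L t))
               fu₂)
  ...   | inj₁ refl = contradiction (inj _ _ _ (u₂∈L t) (u₀∈L t) fu₂ fu₀) (u₂≢u₀ t)
  ...   | inj₂ refl = contradiction (inj _ _ _ (u₂∈L t) (u₁∈L t) fu₂ fu₁) (u₂≢u₁ t)

  -- Hence an injective W-map defined on L maps L into L: L is a subsystem
  -- whose weak preimage contains the distinct points u₀, u₁.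
  injective⇒into-L : InW l d f → InjectiveOnL → LTriple l d → L ⊆ Dom l d f →
                     ∀ x → x ∈ L → Σ (V l d) λ y → (f x ≡ just y) × (y ∈ L)
  injective⇒into-L w inj t L⊆Dom x x∈L
    with value (u₀∈L t) | value (u₁∈L t) | value (u₂∈L t) | value x∈L
    where
    value : ∀ {z} → z ∈ L → ∃ λ c → f z ≡ just c
    value z∈L = to ∈Dom⇔ (L⊆Dom z∈L)
  ... | _ , fu₀ | _ , fu₁ | _ , fu₂ | y , fx with first-two-in-L w inj t fu₀ fu₁ fu₂
  ...   | a₀∈L , a₁∈L = y , fx , to ∈P⇔ (spread w L-subsystem (u₀≢u₁ t) (u₀∈L t) (u₁∈L t)
                                            (mapped⇒∈P fu₀ a₀∈L) (mapped⇒∈P fu₁ a₁∈L) x∈L) fx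

  -- Necessity (ii): a W-map defined on L either identifies two points of L,
  -- and is then constant on L, or is injective on L, hence maps L into L and,
  -- by the pigeonhole principle, permutes L.
  W⇒constant-or-permutation : LTriple l d → L ⊆ Dom l d f → InW l d f →
                              ∣ image l d f L ∣ ≡ 1 ⊎ RestrictionIsPermOfL l d f
  W⇒constant-or-permutation t L⊆Dom w
    with any? (λ x → any? (λ y → (x ∈? L) ×-dec (y ∈? L) ×-dec ¬? (x ≟ y) ×-dec ≡-dec _≟_ (f x) (f y)))
  ... | yes (x₁ , x₂ , x₁∈L , x₂∈L , x₁≢x₂ , fx₁≡fx₂) =
    inj₁ (collapse⇒constant w L⊆Dom x₁≢x₂ x₁∈L x₂∈L fx₁≡fx₂)
  ... | no no-collision = inj₂ (into , injective , injective-into⇒onto L f into injective)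
    where
    injective : InjectiveOnL
    injective x y _ x∈L y∈L fx fy with x ≟ y
    ... | yes x≡y = x≡y
    ... | no x≢y  = contradiction (x , y , x∈L , y∈L , x≢y , trans fx (sym fy)) no-collision
    into : ∀ x → x ∈ L → Σ (V l d) λ y → (f x ≡ just y) × (y ∈ L)
    into = injective⇒into-L w injective t L⊆Dom

-- Lemma 9.2.
lemma9p2 : (l d : ℕ) → 3 ≤ l → 1 ≤ d → (f : PFun l d) →
    (¬ (Lset l d ⊆ Dom l d f) →
        (InW l d f ⇔ (IsOpen l d (Dom l d f) × ∣ image l d f (Lset l d) ∣ ≤ 1)))
    × (Lset l d ⊆ Dom l d f →
        (InW l d f ⇔ (∣ image l d f (Lset l d) ∣ ≡ 1 ⊎ RestrictionIsPermOfL l d f)))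
lemma9p2 l d l≥3 _ f = part-i , part-ii
  where
  open Map l d f

  part-i : ¬ (Lset l d ⊆ Dom l d f) →
           InW l d f ⇔ (IsOpen l d (Dom l d f) × ∣ image l d f (Lset l d) ∣ ≤ 1)
  part-i L⊈Dom = mk⇔ (λ w → W⇒open w , W⇒single-valued w (undefined-point L⊈Dom))
                     (λ (dom-open , one-value) → open-single-valued⇒W dom-open one-value)

  part-ii : Lset l d ⊆ Dom l d f →
            InW l d f ⇔ (∣ image l d f (Lset l d) ∣ ≡ 1 ⊎ RestrictionIsPermOfL l d f)
  part-ii L⊆Dom = mk⇔ (W⇒constant-or-permutation (three-points l≥3) L⊆Dom)
    [ (λ constant → open-single-valued⇒W (L⊆Dom⇒open L⊆Dom) (≤-reflexive constant))
    , permutation⇒W ]
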